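{- Consider the Vanilla algorithm run on an undirected graph $G$. At the beginning of each phase, every tree of the labeled digraph is flat, and a vertex is ongoing if and only if it is incident with a current edge that is not a loop.
   Context: Let $G$ be an undirected graph on $n$ vertices. Every vertex $v$ has a parent $v.p$, initially $v.p = v$; the labeled digraph has arcs $(v, v.p)$; $v$ is a root iff $v.p = v$; a tree (of the labeled digraph, consisting of a root and all vertices whose parent chains lead to it) is flat if its root is the parent of every vertex in it. The algorithm maintains a multiset of current edges, initially the edges of $G$; each edge $\{v,w\}$ is viewed as two arcs $(v,w)$ and $(w,v)$. The Vanilla algorithm repeats the following phase until no current edge other than loops exists: (1) random-vote: every vertex $u$ independently sets $u.l := 1$ with probability $1/2$ and $u.l := 0$ otherwise; (2) link: for every current arc $(v,w)$, if $v.l = 0$ and $w.l = 1$ then set $v.p := w$ (concurrent writes resolved arbitrarily); (3) shortcut: every vertex $u$ simultaneously sets $u.p := u.p.p$; (4) alter: every current edge $\{v,w\}$ is replaced by $\{v.p, w.p\}$. A vertex is ongoing if it is a root but not the only root among the vertices of its connected component in $G$; otherwise it is finished. -}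

module Defs where

open import Data.Nat using (ℕ; zero; suc)
open import Data.Fin using (Fin)
open import Data.Bool using (Bool; true; false)
open import Data.List using (List; map)
open import Data.List.Membership.Propositional using (_∈_)
open import Data.Product using (_×_; _,_; proj₁; proj₂; ∃)
open import Data.Sum using (_⊎_)
open import Relation.Nullary using (¬_)
open import Relation.Binary.PropositionalEquality using (_≡_; _≢_)
open import Relation.Binary.Construct.Closure.ReflexiveTransitive using (Star)

-- An (undirected) edge {v,w} on vertex set Fin n, stored as an ordered pair.
Edge : ℕ → Set
Edge n = Fin n × Fin n

-- A graph / multiset of current edges: a list of edges (multiplicity kept).
Graph : ℕ → Set
Graph n = List (Edge n)

Arc : ∀ {n} → List (Edge n) → Fin n → Fin n → Set
Arc E v w = ((v , w) ∈ E) ⊎ ((w , v) ∈ E)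

SameComponent : ∀ {n} → Graph n → Fin n → Fin n → Set
SameComponent G = Star (Arc G)

iter : ∀ {A : Set} → (A → A) → ℕ → A → A
iter f zero    x = x
iter f (suc k) x = f (iter f k x)

record State (n : ℕ) : Set where
  constructor ⟨_,_⟩
  field
    parent : Fin n → Fin n
    edges  : List (Edge n)
open State public

IsRoot : ∀ {n} → (Fin n → Fin n) → Fin n → Set
IsRoot p v = p v ≡ v

AllTreesFlat : ∀ {n} → (Fin n → Fin n) → Set
AllTreesFlat {n} p = ∀ (r v : Fin n) (k : ℕ) → IsRoot p r → iter p k v ≡ r → p v ≡ r

Ongoing : ∀ {n} → Graph n → (Fin n → Fin n) → Fin n → Set
Ongoing G p v = IsRoot p v × ∃ λ w → SameComponent G v w × IsRoot p w × w ≢ v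

IncidentNonLoop : ∀ {n} → List (Edge n) → Fin n → Set
IncidentNonLoop E v = ∃ λ e → e ∈ E × proj₁ e ≢ proj₂ e × ((proj₁ e ≡ v) ⊎ (proj₂ e ≡ v))

HasNonLoop : ∀ {n} → List (Edge n) → Set
HasNonLoop E = ∃ λ e → e ∈ E × proj₁ e ≢ proj₂ e

-- w is a possible value written to v.p in the link step (votes l: true = 1).
Candidate : ∀ {n} → List (Edge n) → (Fin n → Bool) → Fin n → Fin n → Set
Candidate E l v w = Arc E v w × l v ≡ false × l w ≡ true

-- Link step with arbitrary resolution of concurrent writes:
-- p' is a possible parent function after linking.
LinkResult : ∀ {n} → List (Edge n) → (Fin n → Bool) → (Fin n → Fin n) → (Fin n → Fin n) → Set
LinkResult {n} E l p p' =
  ∀ (v : Fin n) → (p' v ≡ p v × (∀ w → ¬ Candidate E l v w)) ⊎ Candidate E l v (p' v)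

-- One phase (executed only while a non-loop current edge exists):
-- random-vote (any outcome l), link (any resolution p'), shortcut, alter.
data Phase {n : ℕ} : State n → State n → Set where
  phase : ∀ {p E} (l : Fin n → Bool) (p' : Fin n → Fin n) →
          HasNonLoop E → LinkResult E l p p' →
          Phase ⟨ p , E ⟩
                ⟨ (λ u → p' (p' u)) ,
                  map (λ e → (p' (p' (proj₁ e)) , p' (p' (proj₂ e)))) E ⟩

initial : ∀ {n} → Graph n → State n
initial G = ⟨ (λ v → v) , G ⟩

-- States at the beginning of some phase (reachable by zero or more phases).
Reachable : ∀ {n} → Graph n → State n → Set
Reachable G s = Star Phase (initial G) s

module Submission where

-- We isolate an invariant of the pair (parent map p, current
-- edges E) that holds initially and is preserved by every phase:
--   * p is idempotent (p ∘ p = p), which is exactly flatness of all trees;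
--   * both endpoints of every current edge are roots;
--   * every current edge, and every arc (v, p v), joins vertices of the same
--     component of G;
--   * every edge {a, b} of G is "projected" to a path from p a to p b
--     along current edges.
-- Preservation rests on the observation that after linking every vertex points
-- to an old root, and an old root moves at most one step, so one shortcut
-- makes the new parent map idempotent again.  Given the invariant, a root v
-- with another root w in its component is joined to w by a path of current
-- edges (project a G-path), whose first step leaving v is a non-loop edge at
-- v; conversely a non-loop edge at v joins two distinct roots of the same
-- component.

open import Defs
open import Data.Nat using (ℕ; zero; suc)
open import Data.Fin using (Fin)
open import Data.Fin.Properties using (_≟_)
open import Data.Bool using (Bool; true)
open import Data.List using (List; map)
open import Data.List.Membership.Propositional.Properties using (∈-map⁺; ∈-map⁻)
open import Data.Product using (_×_; _,_; proj₁; proj₂; ∃; ∃₂)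
open import Data.Sum using (inj₁; inj₂; swap)
open import Data.Empty using (⊥-elim)
open import Relation.Nullary using (yes; no)
open import Relation.Binary.Core using (_=[_]⇒_)
open import Relation.Binary.PropositionalEquality
open import Relation.Binary.Construct.Closure.ReflexiveTransitive
  using (Star; ε; _◅_; _◅◅_; gmap; reverse; kleisliStar)

module _ {n : ℕ} where
  open import Algebra.Definitions (_≡_ {A = Fin n}) using (IdempotentFun)

  reversePath : ∀ {E : List (Edge n)} {v w} → Star (Arc E) v w → Star (Arc E) w v
  reversePath = reverse swap

  incident⇒arc : ∀ {E : List (Edge n)} {v} → IncidentNonLoop E v → ∃ λ w → Arc E v w × w ≢ v
  incident⇒arc ((a , b) , a∈E , a≢b , inj₁ refl) = b , inj₁ a∈E , λ b≡a → a≢b (sym b≡a)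
  incident⇒arc ((a , b) , b∈E , a≢b , inj₂ refl) = a , inj₂ b∈E , a≢b

  arc⇒incident : ∀ {E : List (Edge n)} {v w} → Arc E v w → w ≢ v → IncidentNonLoop E v
  arc⇒incident (inj₁ e∈E) w≢v = _ , e∈E , (λ v≡w → w≢v (sym v≡w)) , inj₁ refl
  arc⇒incident (inj₂ e∈E) w≢v = _ , e∈E , w≢v , inj₂ refl

  path⇒incident : ∀ {E : List (Edge n)} {v w} → Star (Arc E) v w → w ≢ v → IncidentNonLoop E v
  path⇒incident ε w≢v = ⊥-elim (w≢v refl)
  path⇒incident {v = v} (_◅_ {j = x} arc rest) w≢v with x ≟ v
  ... | yes refl = path⇒incident rest w≢v
  ... | no x≢v   = arc⇒incident arc x≢v

  iter-idempotent : ∀ {p : Fin n → Fin n} → IdempotentFun p → ∀ k v → p (iter p k v) ≡ p v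
  iter-idempotent idem zero    v = refl
  iter-idempotent {p} idem (suc k) v = trans (idem (iter p k v)) (iter-idempotent idem k v)

  idempotent⇒flat : ∀ {p : Fin n → Fin n} → IdempotentFun p → AllTreesFlat p
  idempotent⇒flat idem r v zero    r-root refl  = r-root
  idempotent⇒flat {p} idem r v (suc k) r-root chain = begin
    p v              ≡⟨ sym (iter-idempotent idem k v) ⟩
    p (iter p k v)   ≡⟨ chain ⟩
    r                ∎
    where open ≡-Reasoning

  record Invariant (G : Graph n) (p : Fin n → Fin n) (E : List (Edge n)) : Set where
    field
      idempotent      : IdempotentFun p
      arcFromRoot     : ∀ {v w} → Arc E v w → IsRoot p v
      arcConnected    : ∀ {v w} → Arc E v w → SameComponent G v w
      parentConnected : ∀ v → SameComponent G v (p v)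
      projection      : Arc G =[ p ]⇒ Star (Arc E)

    arcToRoot : ∀ {v w} → Arc E v w → IsRoot p w
    arcToRoot arc = arcFromRoot (swap arc)

  initial-invariant : ∀ (G : Graph n) → Invariant G (λ v → v) G
  initial-invariant G = record
    { idempotent      = λ _ → refl
    ; arcFromRoot     = λ _ → refl
    ; arcConnected    = λ arc → arc ◅ ε
    ; parentConnected = λ _ → ε
    ; projection      = λ arc → arc ◅ ε
    }

  module PhasePreservesInvariant
    {G : Graph n} {p : Fin n → Fin n} {E : List (Edge n)} (I : Invariant G p E)
    (l : Fin n → Bool) (p' : Fin n → Fin n) (link : LinkResult E l p p') where

    open Invariant I

    p'' : Fin n → Fin n
    p'' u = p' (p' u)

    alter : Edge n → Edge n
    alter e = (p'' (proj₁ e) , p'' (proj₂ e))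

    E' : List (Edge n)
    E' = map alter E

    voter-keeps-parent : ∀ u → l u ≡ true → p' u ≡ p u
    voter-keeps-parent u lu≡true with link u
    ... | inj₁ (kept , _)         = kept
    ... | inj₂ (_ , lu≡false , _) with trans (sym lu≡false) lu≡true
    ...   | ()

    -- After linking, every vertex points to an old root: its old (root)
    -- parent, or the head of a current arc.
    link-to-root : ∀ u → IsRoot p (p' u)
    link-to-root u with link u
    ... | inj₁ (kept , _)    rewrite kept = idempotent u
    ... | inj₂ (arc , _ , _) = arcToRoot arc

    -- An old root moves at most one step: it stays, or links to a root that
    -- voted 1 and hence stays.
    root-moves-once : ∀ r → IsRoot p r → p' (p' r) ≡ p' r
    root-moves-once r r-root with link r
    ... | inj₁ (kept , _)        = cong p' (trans kept r-root)
    ... | inj₂ (arc , _ , lw≡true) = trans (voter-keeps-parent (p' r) lw≡true) (arcToRoot arc)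

    shortcut-fixed : ∀ u → p' (p'' u) ≡ p'' u
    shortcut-fixed u = root-moves-once (p' u) (link-to-root u)

    shortcut-idempotent : IdempotentFun p''
    shortcut-idempotent u = trans (cong p' (shortcut-fixed u)) (shortcut-fixed u)

    shortcut-absorbs-parent : ∀ a → p'' (p a) ≡ p'' a
    shortcut-absorbs-parent a with link a
    ... | inj₁ (kept , _)    = trans (cong p'' (sym kept)) (shortcut-fixed a)
    ... | inj₂ (arc , _ , _) = cong p'' (arcFromRoot arc)

    link-connected : ∀ v → SameComponent G v (p' v)
    link-connected v with link v
    ... | inj₁ (kept , _)    = subst (SameComponent G v) (sym kept) (parentConnected v)
    ... | inj₂ (arc , _ , _) = arcConnected arc

    shortcut-connected : ∀ v → SameComponent G v (p'' v)
    shortcut-connected v = link-connected v ◅◅ link-connected (p' v)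

    alter-arc : ∀ {a b} → Arc E a b → Arc E' (p'' a) (p'' b)
    alter-arc (inj₁ e∈E) = inj₁ (∈-map⁺ alter e∈E)
    alter-arc (inj₂ e∈E) = inj₂ (∈-map⁺ alter e∈E)

    alter-arc⁻ : ∀ {x y} → Arc E' x y → ∃₂ λ a b → Arc E a b × x ≡ p'' a × y ≡ p'' b
    alter-arc⁻ (inj₁ e∈E') with ∈-map⁻ alter e∈E'
    ... | (a , b) , e∈E , refl = a , b , inj₁ e∈E , refl , refl
    alter-arc⁻ (inj₂ e∈E') with ∈-map⁻ alter e∈E'
    ... | (a , b) , e∈E , refl = b , a , inj₂ e∈E , refl , refl

    invariant' : Invariant G p'' E'
    invariant' = record
      { idempotent      = shortcut-idempotent
      ; arcFromRoot     = arcFromRoot'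
      ; arcConnected    = arcConnected'
      ; parentConnected = shortcut-connected
      ; projection      = λ {a} {b} arc →
          subst₂ (Star (Arc E')) (shortcut-absorbs-parent a) (shortcut-absorbs-parent b)
                 (gmap p'' alter-arc (projection arc))
      }
      where
      arcFromRoot' : ∀ {x y} → Arc E' x y → IsRoot p'' x
      arcFromRoot' arc' with alter-arc⁻ arc'
      ... | a , _ , _ , refl , _ = shortcut-idempotent a

      arcConnected' : ∀ {x y} → Arc E' x y → SameComponent G x y
      arcConnected' arc' with alter-arc⁻ arc'
      ... | a , b , arc , refl , refl =
        reversePath (shortcut-connected a) ◅◅ arcConnected arc ◅◅ shortcut-connected b

  reachable-invariant : ∀ {G : Graph n} {s s'} → Star Phase s s' →
                        Invariant G (parent s) (edges s) → Invariant G (parent s') (edges s')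
  reachable-invariant ε I = I
  reachable-invariant (phase l p' _ link ◅ rest) I =
    reachable-invariant rest (PhasePreservesInvariant.invariant' I l p' link)

  -- Under the invariant, an ongoing root is joined to another root by a path
  -- of current edges, obtained by projecting a path in G.
  ongoing⇒incident : ∀ {G p E v} → Invariant G p E → Ongoing G p v → IncidentNonLoop E v
  ongoing⇒incident {E = E} I (v-root , w , v~w , w-root , w≢v) =
    path⇒incident (subst₂ (Star (Arc E)) v-root w-root (kleisliStar _ projection v~w)) w≢v
    where open Invariant I

  incident⇒ongoing : ∀ {G p E v} → Invariant G p E → IncidentNonLoop E v → Ongoing G p v
  incident⇒ongoing I incident with incident⇒arc incident
  ... | w , arc , w≢v = arcFromRoot arc , w , arcConnected arc , arcToRoot arc , w≢v
    where open Invariant I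

lemma3p2 : ∀ (n : ℕ) (G : Graph n) (s : State n) → Reachable G s →
    AllTreesFlat (parent s) ×
    (∀ (v : Fin n) → (Ongoing G (parent s) v → IncidentNonLoop (edges s) v) ×
                     (IncidentNonLoop (edges s) v → Ongoing G (parent s) v))
lemma3p2 n G s reachable =
  idempotent⇒flat (Invariant.idempotent I) , λ v → ongoing⇒incident I , incident⇒ongoing I
  where
  I : Invariant G (parent s) (edges s)
  I = reachable-invariant reachable (initial-invariant G)
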